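{- Let $A$ be an integer weighing matrix whose H-equivalence class is symmetric, and let $s,s':\mathbb Z/2\to\mathrm{TAut}(A)$ be two sections of the projection $\mathrm{TAut}(A)\to\mathbb Z/2$. Then $s$ and $s'$ are equivalent (i.e. there is $g\in\mathrm{TAut}(A)$ with $s'(a)=g\,s(a)\,g^{ -1}$ for all $a\in\mathbb Z/2$) if and only if the symmetric matrices $\sigma(s)$ and $\sigma(s')$ are SH-equivalent.
   Context: An integer weighing matrix is $A\in\mathbb Z^{n\times n}$ with $AA^\top=kI$. $\mathrm{Mon}(n)$: monomial $n\times n$ matrices with entries in $\{0,\pm1\}$. $\mathrm{Aut}(A)=\{(L,R)\in\mathrm{Mon}(n)^2:LAR^\top=A\}$. The class $[A]=\{LAR^\top\}$ is symmetric if $A^\top\in[A]$. For such $A$, $\mathrm{TAut}(A)$ is the group whose elements are the pairs $(L,R)\in\mathrm{Aut}(A)$ together with formal triples $(L,R,\top)$ with $L,R\in\mathrm{Mon}(n)$ and $LA^\top R^\top=A$ (thought of as the operation $X\mapsto LX^\top R^\top$), with multiplication given by composition of these operations: $(L_1,R_1)(L_2,R_2)=(L_1L_2,R_1R_2)$, $(L_1,R_1)(L_2,R_2,\top)=(L_1L_2,R_1R_2,\top)$, $(L_1,R_1,\top)(L_2,R_2)=(L_1R_2,R_1L_2,\top)$, $(L_1,R_1,\top)(L_2,R_2,\top)=(L_1R_2,R_1L_2)$. The projection $\mathrm{TAut}(A)\to\mathbb Z/2$ sends pairs to $0$ and triples to $1$, giving an exact sequence $1\to\mathrm{Aut}(A)\to\mathrm{TAut}(A)\to\mathbb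 Z/2\to1$. A section is a homomorphism $s:\mathbb Z/2\to\mathrm{TAut}(A)$ composing with the projection to the identity; writing $s(1)=(L,R,\top)$, one sets $\sigma(s):=L^\top A$ (a symmetric matrix in $[A]$). Two symmetric matrices $B,C$ are SH-equivalent if $C=MBM^\top$ for some $M\in\mathrm{Mon}(n)$. -}

module Defs where

open import Data.Nat using (ℕ; zero; suc)
open import Data.Fin using (Fin; zero; suc)
open import Data.Integer using (ℤ; +_; -[1+_]; _+_; _*_)
open import Data.Bool using (Bool; true; false; _xor_)
open import Data.Product using (Σ; ∃; _×_; _,_)
open import Data.Sum using (_⊎_)
open import Relation.Binary.PropositionalEquality using (_≡_; _≢_)
open import Relation.Nullary using (¬_)

Mat : ℕ → Set
Mat n = Fin n → Fin n → ℤ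

∑ : {n : ℕ} → (Fin n → ℤ) → ℤ
∑ {zero}  f = + 0
∑ {suc n} f = f zero + ∑ (λ i → f (suc i))

_⊗_ : {n : ℕ} → Mat n → Mat n → Mat n
(M ⊗ N) i j = ∑ (λ l → M i l * N l j)
infixl 7 _⊗_

_ᵀ : {n : ℕ} → Mat n → Mat n
(M ᵀ) i j = M j i
infix 8 _ᵀ

δ : {n : ℕ} → Fin n → Fin n → ℤ
δ zero    zero    = + 1
δ zero    (suc j) = + 0
δ (suc i) zero    = + 0
δ (suc i) (suc j) = δ i j

I : {n : ℕ} → Mat n
I = δ

scal : {n : ℕ} → ℤ → Mat n → Mat n
scal k M i j = k * M i j

_≋_ : {n : ℕ} → Mat n → Mat n → Set
M ≋ N = ∀ i j → M i j ≡ N i j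
infix 4 _≋_

IsWeighing : {n : ℕ} → Mat n → Set
IsWeighing {n} A = Σ ℤ λ k → A ⊗ A ᵀ ≋ scal k I

Trit : ℤ → Set
Trit x = (x ≡ + 0) ⊎ ((x ≡ + 1) ⊎ (x ≡ -[1+ 0 ]))

IsMon : {n : ℕ} → Mat n → Set
IsMon {n} M =
  (∀ i j → Trit (M i j)) ×
  ((∀ i → Σ (Fin n) λ j → (M i j ≢ + 0) × (∀ j' → M i j' ≢ + 0 → j' ≡ j)) ×
   (∀ j → Σ (Fin n) λ i → (M i j ≢ + 0) × (∀ i' → M i' j ≢ + 0 → i' ≡ i)))

-- H-equivalence class [A] = { L A Rᵀ }
InClass : {n : ℕ} → Mat n → Mat n → Set
InClass {n} A B = Σ (Mat n) λ L → Σ (Mat n) λ R → IsMon L × IsMon R × (B ≋ L ⊗ A ⊗ R ᵀ)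

SymmetricClass : {n : ℕ} → Mat n → Set
SymmetricClass A = InClass A (A ᵀ)

-- Elements of TAut(A) (raw): pairs (L,R) and formal triples (L,R,⊤)
data TElem (n : ℕ) : Set where
  pair   : Mat n → Mat n → TElem n
  triple : Mat n → Mat n → TElem n

InTAut : {n : ℕ} → Mat n → TElem n → Set
InTAut A (pair L R)   = IsMon L × IsMon R × (L ⊗ A ⊗ R ᵀ ≋ A)
InTAut A (triple L R) = IsMon L × IsMon R × (L ⊗ A ᵀ ⊗ R ᵀ ≋ A)

_·_ : {n : ℕ} → TElem n → TElem n → TElem n
pair L₁ R₁   · pair L₂ R₂   = pair (L₁ ⊗ L₂) (R₁ ⊗ R₂)
pair L₁ R₁   · triple L₂ R₂ = triple (L₁ ⊗ L₂) (R₁ ⊗ R₂)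
triple L₁ R₁ · pair L₂ R₂   = triple (L₁ ⊗ R₂) (R₁ ⊗ L₂)
triple L₁ R₁ · triple L₂ R₂ = pair (L₁ ⊗ R₂) (R₁ ⊗ L₂)
infixl 7 _·_

-- identity and inverse (for monomial L,R one has L⁻¹ = Lᵀ)
e : {n : ℕ} → TElem n
e = pair I I

inv : {n : ℕ} → TElem n → TElem n
inv (pair L R)   = pair (L ᵀ) (R ᵀ)
inv (triple L R) = triple (R ᵀ) (L ᵀ)

_≈_ : {n : ℕ} → TElem n → TElem n → Set
pair L R   ≈ pair L' R'   = (L ≋ L') × (R ≋ R')
triple L R ≈ triple L' R' = (L ≋ L') × (R ≋ R')
_ ≈ _ = Data.Empty.⊥
  where import Data.Empty
infix 4 _≈_

-- projection TAut(A) → ℤ/2 (ℤ/2 modelled as Bool with xor)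
proj : {n : ℕ} → TElem n → Bool
proj (pair _ _)   = false
proj (triple _ _) = true

IsSection : {n : ℕ} → Mat n → (Bool → TElem n) → Set
IsSection A s =
  (∀ a → InTAut A (s a)) ×
  ((∀ a b → s (a xor b) ≈ s a · s b) ×
   (∀ a → proj (s a) ≡ a))

EquivSections : {n : ℕ} → Mat n → (Bool → TElem n) → (Bool → TElem n) → Set
EquivSections {n} A s s' =
  Σ (TElem n) λ g → InTAut A g × (∀ a → s' a ≈ g · s a · inv g)

-- σ(s) := Lᵀ A where s(1) = (L,R,⊤).  (For a section s(1) is always a triple;
-- the pair branch is never used for sections.)
σ : {n : ℕ} → Mat n → (Bool → TElem n) → Mat n
σ A s with s true
... | triple L R = L ᵀ ⊗ A
... | pair L R   = A

SHEquiv : {n : ℕ} → Mat n → Mat n → Set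
SHEquiv {n} B C = Σ (Mat n) λ M → IsMon M × (C ≋ M ⊗ B ⊗ M ᵀ)

-- Write s(1) = (L, R, ⊤) and s(0) = (L₀, R₀).  Since s(0) is idempotent and monomial matrices are
-- orthogonal, s(0) = (I, I); then s(1)² = s(0) gives L R = I, i.e. R = Lᵀ, and s(1) ∈ TAut(A) reads
-- L Aᵀ L = A.  Conjugating by a pair (P, Q) ∈ Aut(A) replaces L by P L Qᵀ, and as Pᵀ A = A Qᵀ this
-- turns σ(s) = Lᵀ A into Q σ(s) Qᵀ.  A triple (P, Q, ⊤) is the pair (P Lᵀ, Q L) followed by s(1),
-- which commutes with s, so it acts on σ(s) as congruence by Q L.  Conversely, if
-- L'ᵀ A = M (Lᵀ A) Mᵀ, then the pair (L' M Lᵀ, M) lies in Aut(A) and conjugates s to s'.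

module Submission where

open import Defs
open import Data.Nat using (ℕ)
open import Data.Bool using (Bool)
open import Data.Product using (_×_)

open import Algebra.Bundles using (Monoid)
open import Data.Bool using (true; false)
open import Data.Empty using (⊥-elim)
open import Data.Fin using (Fin; zero; suc; punchIn)
open import Data.Fin.Properties using (punchInᵢ≢i) renaming (_≟_ to _≟ᶠ_)
open import Data.Integer using (ℤ; 0ℤ; 1ℤ; _+_; _*_)
open import Data.Integer.Properties
  using (+-*-semiring; _≟_; i*j≡0⇒i≡0∨j≡0; +-identityʳ; *-assoc; *-comm; *-identityˡ; *-identityʳ; *-zeroʳ)
open import Algebra.Properties.Semiring.Sum +-*-semiring
  using (sum; sum-cong-≗; sum-remove; sum-replicate-zero; ∑-comm; *-distribˡ-sum; *-distribʳ-sum)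
open import Data.Nat using (zero; suc)
open import Data.Product using (Σ; _,_; proj₁; proj₂)
open import Data.Sum using (inj₁; inj₂; [_,_]′)
open import Data.Vec.Functional using (replicate)
open import Function using (_∘_)
open import Level using (0ℓ; _⊔_) renaming (suc to lsuc)
open import Relation.Binary.Bundles using (Setoid)
open import Relation.Binary.PropositionalEquality
  using (_≡_; _≢_; refl; sym; trans; cong; cong₂; subst; subst₂; module ≡-Reasoning)
open import Relation.Nullary using (yes; no)
open import Relation.Nullary.Decidable using (decidable-stable)

record Dagger {c ℓ} (M : Monoid c ℓ) u : Set (c ⊔ ℓ ⊔ lsuc u) where
  open Monoid M using (Carrier; _∙_; ε) renaming (_≈_ to _≃_)
  infix 8 _†
  field
    _†             : Carrier → Carrier
    †-cong         : ∀ {x y} → x ≃ y → x † ≃ y †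
    †-involutive   : ∀ x → x † † ≃ x
    †-anti-homo-∙  : ∀ x y → (x ∙ y) † ≃ y † ∙ x †
    Unitary        : Carrier → Set u
    Unitary-†      : ∀ {x} → Unitary x → Unitary (x †)
    Unitary-∙      : ∀ {x y} → Unitary x → Unitary y → Unitary (x ∙ y)
    Unitary⇒x∙x†≃ε : ∀ {x} → Unitary x → x ∙ x † ≃ ε

module DaggerProperties {c ℓ u} {M : Monoid c ℓ} (D : Dagger M u) where

  open Monoid M renaming (_≈_ to _≃_; refl to ≃-refl; sym to ≃-sym; trans to ≃-trans)
  open Dagger D
  open import Algebra.Properties.Monoid M using (insertˡ; insertʳ; cancelˡ; cancelʳ)
  open import Algebra.Properties.Semigroup semigroup using ([uv∙w]x≈u[v∙wx]; [u∙vw]x≈uv∙wx)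
  open import Relation.Binary.Reasoning.Setoid setoid

  private
    variable
      a l l' m p q r r' x y z : Carrier

  Unitary⇒x†∙x≃ε : Unitary x → x † ∙ x ≃ ε
  Unitary⇒x†∙x≃ε {x} x-unitary =
    ≃-trans (∙-congˡ (≃-sym (†-involutive x))) (Unitary⇒x∙x†≃ε (Unitary-† x-unitary))

  †-anti-homo-∙₃ : ∀ x y z → (x ∙ y ∙ z) † ≃ z † ∙ y † ∙ x †
  †-anti-homo-∙₃ x y z = begin
    (x ∙ y ∙ z) †       ≈⟨ †-anti-homo-∙ (x ∙ y) z ⟩
    z † ∙ (x ∙ y) †     ≈⟨ ∙-congˡ (†-anti-homo-∙ x y) ⟩
    z † ∙ (y † ∙ x †)   ≈⟨ assoc (z †) (y †) (x †) ⟨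
    z † ∙ y † ∙ x †     ∎

  x∙y≃z⇒y≃x†∙z : Unitary x → x ∙ y ≃ z → y ≃ x † ∙ z
  x∙y≃z⇒y≃x†∙z {x} {y} {z} x-unitary xy≃z = begin
    y               ≈⟨ insertˡ (Unitary⇒x†∙x≃ε x-unitary) y ⟩
    x † ∙ (x ∙ y)   ≈⟨ ∙-congˡ xy≃z ⟩
    x † ∙ z         ∎

  y∙x≃z⇒y≃z∙x† : Unitary x → y ∙ x ≃ z → y ≃ z ∙ x †
  y∙x≃z⇒y≃z∙x† {x} {y} {z} x-unitary yx≃z = begin
    y               ≈⟨ insertʳ (Unitary⇒x∙x†≃ε x-unitary) y ⟩
    y ∙ x ∙ x †     ≈⟨ ∙-congʳ yx≃z ⟩
    z ∙ x †         ∎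

  x∙y≃ε⇒y≃x† : Unitary x → x ∙ y ≃ ε → y ≃ x †
  x∙y≃ε⇒y≃x† {x} x-unitary xy≃ε = ≃-trans (x∙y≃z⇒y≃x†∙z x-unitary xy≃ε) (identityʳ (x †))

  x≃x∙x⇒x≃ε : Unitary x → x ≃ x ∙ x → x ≃ ε
  x≃x∙x⇒x≃ε x-unitary x≃xx =
    ≃-trans (x∙y≃z⇒y≃x†∙z x-unitary (≃-sym x≃xx)) (Unitary⇒x†∙x≃ε x-unitary)

  x≃ε∧y≃ε⇒y≃z∙x∙z† : Unitary z → x ≃ ε → y ≃ ε → y ≃ z ∙ x ∙ z †
  x≃ε∧y≃ε⇒y≃z∙x∙z† {z} {x} {y} z-unitary x≃ε y≃ε = begin
    y            ≈⟨ y≃ε ⟩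
    ε            ≈⟨ Unitary⇒x∙x†≃ε z-unitary ⟨
    z ∙ z †      ≈⟨ ∙-congʳ (identityʳ z) ⟨
    z ∙ ε ∙ z †  ≈⟨ ∙-congʳ (∙-congˡ x≃ε) ⟨
    z ∙ x ∙ z †  ∎

  †-conjugate : l' ≃ p ∙ l ∙ q † → l' † ≃ q ∙ l † ∙ p †
  †-conjugate {l'} {p} {l} {q} l'≃plq† = begin
    l' †                 ≈⟨ †-cong l'≃plq† ⟩
    (p ∙ l ∙ q †) †      ≈⟨ †-anti-homo-∙₃ p l (q †) ⟩
    q † † ∙ l † ∙ p †    ≈⟨ ∙-congʳ (∙-congʳ (†-involutive q)) ⟩
    q ∙ l † ∙ p †        ∎

  congruence-of-conjugate : Unitary p → p ∙ a ∙ q † ≃ a → l' ≃ p ∙ l ∙ q † →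
                            l' † ∙ a ≃ q ∙ (l † ∙ a) ∙ q †
  congruence-of-conjugate {p} {a} {q} {l'} {l} p-unitary paq†≃a l'≃plq† = begin
    l' † ∙ a                ≈⟨ ∙-congʳ (†-conjugate l'≃plq†) ⟩
    q ∙ l † ∙ p † ∙ a       ≈⟨ assoc (q ∙ l †) (p †) a ⟩
    q ∙ l † ∙ (p † ∙ a)     ≈⟨ ∙-congˡ p†a≃aq† ⟩
    q ∙ l † ∙ (a ∙ q †)     ≈⟨ [u∙vw]x≈uv∙wx q (l †) a (q †) ⟨
    q ∙ (l † ∙ a) ∙ q †     ∎
    where
    p†a≃aq† : p † ∙ a ≃ a ∙ q †
    p†a≃aq† = ≃-sym (x∙y≃z⇒y≃x†∙z p-unitary (≃-trans (≃-sym (assoc p a (q †))) paq†≃a))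

  l∙a†∙l≃a⇒a†≃l†∙[a∙l†] : Unitary l → l ∙ a † ∙ l ≃ a → a † ≃ l † ∙ (a ∙ l †)
  l∙a†∙l≃a⇒a†≃l†∙[a∙l†] l-unitary la†l≃a =
    x∙y≃z⇒y≃x†∙z l-unitary (y∙x≃z⇒y≃z∙x† l-unitary la†l≃a)

  twisted-fixes : Unitary l → l ∙ a † ∙ l ≃ a → p ∙ a † ∙ q † ≃ a → p ∙ l † ∙ a ∙ (q ∙ l) † ≃ a
  twisted-fixes {l} {a} {p} {q} l-unitary la†l≃a pa†q†≃a = begin
    p ∙ l † ∙ a ∙ (q ∙ l) †     ≈⟨ ∙-congˡ (†-anti-homo-∙ q l) ⟩
    p ∙ l † ∙ a ∙ (l † ∙ q †)   ≈⟨ assoc (p ∙ l † ∙ a) (l †) (q †) ⟨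
    p ∙ l † ∙ a ∙ l † ∙ q †     ≈⟨ ∙-congʳ ([uv∙w]x≈u[v∙wx] p (l †) a (l †)) ⟩
    p ∙ (l † ∙ (a ∙ l †)) ∙ q † ≈⟨ ∙-congʳ (∙-congˡ (l∙a†∙l≃a⇒a†≃l†∙[a∙l†] l-unitary la†l≃a)) ⟨
    p ∙ a † ∙ q †               ≈⟨ pa†q†≃a ⟩
    a                           ∎

  twisted-conjugate : Unitary l → r ≃ l † → l' ≃ p ∙ r ∙ q † → l' ≃ p ∙ l † ∙ l ∙ (q ∙ l) †
  twisted-conjugate {l} {r} {l'} {p} {q} l-unitary r≃l† l'≃prq† = begin
    l'                          ≈⟨ l'≃prq† ⟩
    p ∙ r ∙ q †                 ≈⟨ ∙-congʳ (∙-congˡ r≃l†) ⟩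
    p ∙ l † ∙ q †               ≈⟨ ∙-congˡ (cancelˡ (Unitary⇒x∙x†≃ε l-unitary) (q †)) ⟨
    p ∙ l † ∙ (l ∙ (l † ∙ q †)) ≈⟨ assoc (p ∙ l †) l (l † ∙ q †) ⟨
    p ∙ l † ∙ l ∙ (l † ∙ q †)   ≈⟨ ∙-congˡ (†-anti-homo-∙ q l) ⟨
    p ∙ l † ∙ l ∙ (q ∙ l) †     ∎

  congruence-of-twisted-conjugate : Unitary p → Unitary l → l ∙ a † ∙ l ≃ a → p ∙ a † ∙ q † ≃ a →
                                    r ≃ l † → l' ≃ p ∙ r ∙ q † →
                                    l' † ∙ a ≃ (q ∙ l) ∙ (l † ∙ a) ∙ (q ∙ l) †
  congruence-of-twisted-conjugate p-unitary l-unitary la†l≃a pa†q†≃a r≃l† l'≃prq† =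
    congruence-of-conjugate (Unitary-∙ p-unitary (Unitary-† l-unitary))
      (twisted-fixes l-unitary la†l≃a pa†q†≃a) (twisted-conjugate l-unitary r≃l† l'≃prq†)

  congruence-fixes : Unitary l' → l' † ∙ a ≃ m ∙ (l † ∙ a) ∙ m † → l' ∙ m ∙ l † ∙ a ∙ m † ≃ a
  congruence-fixes {l'} {a} {m} {l} l'-unitary l'†a≃m[l†a]m† = begin
    l' ∙ m ∙ l † ∙ a ∙ m †        ≈⟨ ∙-congʳ ([uv∙w]x≈u[v∙wx] l' m (l †) a) ⟩
    l' ∙ (m ∙ (l † ∙ a)) ∙ m †    ≈⟨ assoc l' (m ∙ (l † ∙ a)) (m †) ⟩
    l' ∙ (m ∙ (l † ∙ a) ∙ m †)    ≈⟨ ∙-congˡ l'†a≃m[l†a]m† ⟨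
    l' ∙ (l' † ∙ a)               ≈⟨ cancelˡ (Unitary⇒x∙x†≃ε l'-unitary) a ⟩
    a                             ∎

  congruence-conjugates : Unitary l → Unitary m → r ≃ l † → r' ≃ l' † →
                          (l' ≃ (l' ∙ m ∙ l †) ∙ l ∙ m †) × (r' ≃ m ∙ r ∙ (l' ∙ m ∙ l †) †)
  congruence-conjugates {l} {m} {r} {r'} {l'} l-unitary m-unitary r≃l† r'≃l'† = l'≃p∙l∙m† , (begin
    r'                          ≈⟨ r'≃l'† ⟩
    l' †                        ≈⟨ †-conjugate l'≃p∙l∙m† ⟩
    m ∙ l † ∙ (l' ∙ m ∙ l †) †  ≈⟨ ∙-congʳ (∙-congˡ r≃l†) ⟨
    m ∙ r ∙ (l' ∙ m ∙ l †) †    ∎)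
    where
    l'≃p∙l∙m† : l' ≃ l' ∙ m ∙ l † ∙ l ∙ m †
    l'≃p∙l∙m† = ≃-sym (begin
      l' ∙ m ∙ l † ∙ l ∙ m †   ≈⟨ ∙-congʳ (cancelʳ (Unitary⇒x†∙x≃ε l-unitary) (l' ∙ m)) ⟩
      l' ∙ m ∙ m †             ≈⟨ cancelʳ (Unitary⇒x∙x†≃ε m-unitary) l' ⟩
      l'                       ∎)

∑≡sum : ∀ {n} (f : Fin n → ℤ) → ∑ f ≡ sum f
∑≡sum {zero}  f = refl
∑≡sum {suc n} f = cong (f zero +_) (∑≡sum (f ∘ suc))

∑-cong : ∀ {n} {f g : Fin n → ℤ} → (∀ i → f i ≡ g i) → ∑ f ≡ ∑ g
∑-cong {f = f} {g} f≗g = trans (∑≡sum f) (trans (sum-cong-≗ f≗g) (sym (∑≡sum g)))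

∑-single : ∀ {n} (c : Fin n) (f : Fin n → ℤ) → (∀ l → l ≢ c → f l ≡ 0ℤ) → ∑ f ≡ f c
∑-single {suc n} c f off = begin
  ∑ f                            ≡⟨ ∑≡sum f ⟩
  sum f                          ≡⟨ sum-remove f ⟩
  f c + sum (f ∘ punchIn c)      ≡⟨ cong (f c +_) (sum-cong-≗ (λ l → off (punchIn c l) (punchInᵢ≢i c l))) ⟩
  f c + sum (replicate n 0ℤ)     ≡⟨ cong (f c +_) (sum-replicate-zero n) ⟩
  f c + 0ℤ                       ≡⟨ +-identityʳ (f c) ⟩
  f c                            ∎
  where open ≡-Reasoning

≋-setoid : ℕ → Setoid 0ℓ 0ℓ
≋-setoid n = record
  { Carrier       = Mat n
  ; _≈_           = _≋_
  ; isEquivalence = record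
    { refl  = λ i j → refl
    ; sym   = λ p i j → sym (p i j)
    ; trans = λ p q i j → trans (p i j) (q i j)
    }
  }

module _ {n : ℕ} where
  open Setoid (≋-setoid n) public using () renaming (refl to ≋-refl; sym to ≋-sym; trans to ≋-trans)

⊗-entry : ∀ {n} (M N : Mat n) i j → (M ⊗ N) i j ≡ sum (λ l → M i l * N l j)
⊗-entry M N i j = ∑≡sum (λ l → M i l * N l j)

⊗-cong : ∀ {n} {M M' N N' : Mat n} → M ≋ M' → N ≋ N' → M ⊗ N ≋ M' ⊗ N'
⊗-cong p q i j = ∑-cong (λ l → cong₂ _*_ (p i l) (q l j))

⊗-assoc : ∀ {n} (M N P : Mat n) → M ⊗ N ⊗ P ≋ M ⊗ (N ⊗ P)
⊗-assoc M N P i j = begin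
  ((M ⊗ N) ⊗ P) i j
    ≡⟨ ⊗-entry (M ⊗ N) P i j ⟩
  sum (λ l → (M ⊗ N) i l * P l j)
    ≡⟨ sum-cong-≗ (λ l → cong (_* P l j) (⊗-entry M N i l)) ⟩
  sum (λ l → sum (λ m → M i m * N m l) * P l j)
    ≡⟨ sum-cong-≗ (λ l → *-distribʳ-sum (P l j) (λ m → M i m * N m l)) ⟩
  sum (λ l → sum (λ m → M i m * N m l * P l j))
    ≡⟨ sum-cong-≗ (λ l → sum-cong-≗ (λ m → *-assoc (M i m) (N m l) (P l j))) ⟩
  sum (λ l → sum (λ m → M i m * (N m l * P l j)))
    ≡⟨ ∑-comm (λ l m → M i m * (N m l * P l j)) ⟩
  sum (λ m → sum (λ l → M i m * (N m l * P l j)))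
    ≡⟨ sum-cong-≗ (λ m → sym (*-distribˡ-sum (M i m) (λ l → N m l * P l j))) ⟩
  sum (λ m → M i m * sum (λ l → N m l * P l j))
    ≡⟨ sum-cong-≗ (λ m → cong (M i m *_) (sym (⊗-entry N P m j))) ⟩
  sum (λ m → M i m * (N ⊗ P) m j)
    ≡⟨ sym (⊗-entry M (N ⊗ P) i j) ⟩
  (M ⊗ (N ⊗ P)) i j ∎
  where open ≡-Reasoning

δ-refl : ∀ {n} (i : Fin n) → δ i i ≡ 1ℤ
δ-refl zero    = refl
δ-refl (suc i) = δ-refl i

δ-≢ : ∀ {n} {i j : Fin n} → i ≢ j → δ i j ≡ 0ℤ
δ-≢ {i = zero}  {zero}  i≢j = ⊥-elim (i≢j refl)
δ-≢ {i = zero}  {suc j} i≢j = refl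
δ-≢ {i = suc i} {zero}  i≢j = refl
δ-≢ {i = suc i} {suc j} i≢j = δ-≢ (i≢j ∘ cong suc)

⊗-identityˡ : ∀ {n} (M : Mat n) → I ⊗ M ≋ M
⊗-identityˡ M i j = begin
  ∑ (λ l → δ i l * M l j) ≡⟨ ∑-single i _ (λ l l≢i → cong (_* M l j) (δ-≢ (l≢i ∘ sym))) ⟩
  δ i i * M i j           ≡⟨ cong (_* M i j) (δ-refl i) ⟩
  1ℤ * M i j              ≡⟨ *-identityˡ (M i j) ⟩
  M i j                   ∎
  where open ≡-Reasoning

⊗-identityʳ : ∀ {n} (M : Mat n) → M ⊗ I ≋ M
⊗-identityʳ M i j = begin
  ∑ (λ l → M i l * δ l j) ≡⟨ ∑-single j _ (λ l l≢j → trans (cong (M i l *_) (δ-≢ l≢j)) (*-zeroʳ (M i l))) ⟩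
  M i j * δ j j           ≡⟨ cong (M i j *_) (δ-refl j) ⟩
  M i j * 1ℤ              ≡⟨ *-identityʳ (M i j) ⟩
  M i j                   ∎
  where open ≡-Reasoning

ᵀ-cong : ∀ {n} {M N : Mat n} → M ≋ N → M ᵀ ≋ N ᵀ
ᵀ-cong p i j = p j i

ᵀ-involutive : ∀ {n} (M : Mat n) → M ᵀ ᵀ ≋ M
ᵀ-involutive M = ≋-refl

ᵀ-anti-homo-⊗ : ∀ {n} (M N : Mat n) → (M ⊗ N) ᵀ ≋ N ᵀ ⊗ M ᵀ
ᵀ-anti-homo-⊗ M N i j = ∑-cong (λ l → *-comm (M j l) (N l i))

⊗-monoid : ℕ → Monoid 0ℓ 0ℓ
⊗-monoid n = record
  { Carrier  = Mat n
  ; _≈_      = _≋_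
  ; _∙_      = _⊗_
  ; ε        = I
  ; isMonoid = record
    { isSemigroup = record
      { isMagma = record { isEquivalence = Setoid.isEquivalence (≋-setoid n) ; ∙-cong = ⊗-cong }
      ; assoc   = ⊗-assoc
      }
    ; identity = ⊗-identityˡ , ⊗-identityʳ
    }
  }

Trit-* : ∀ {x y} → Trit x → Trit y → Trit (x * y)
Trit-* (inj₁ refl)          _                    = inj₁ refl
Trit-* {x} (inj₂ _)         (inj₁ refl)          = inj₁ (*-zeroʳ x)
Trit-* (inj₂ (inj₁ refl))   (inj₂ (inj₁ refl))   = inj₂ (inj₁ refl)
Trit-* (inj₂ (inj₁ refl))   (inj₂ (inj₂ refl))   = inj₂ (inj₂ refl)
Trit-* (inj₂ (inj₂ refl))   (inj₂ (inj₁ refl))   = inj₂ (inj₂ refl)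
Trit-* (inj₂ (inj₂ refl))   (inj₂ (inj₂ refl))   = inj₂ (inj₁ refl)

Trit∧≢0⇒x*x≡1 : ∀ {x} → Trit x → x ≢ 0ℤ → x * x ≡ 1ℤ
Trit∧≢0⇒x*x≡1 (inj₁ x≡0)         x≢0 = ⊥-elim (x≢0 x≡0)
Trit∧≢0⇒x*x≡1 (inj₂ (inj₁ refl)) _   = refl
Trit∧≢0⇒x*x≡1 (inj₂ (inj₂ refl)) _   = refl

module Monomial {n : ℕ} {M : Mat n} (mon : IsMon M) where

  col : Fin n → Fin n
  col i = proj₁ (proj₁ (proj₂ mon) i)

  row : Fin n → Fin n
  row j = proj₁ (proj₂ (proj₂ mon) j)

  entry-col≢0 : ∀ i → M i (col i) ≢ 0ℤ
  entry-col≢0 i = proj₁ (proj₂ (proj₁ (proj₂ mon) i))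

  entry-row≢0 : ∀ j → M (row j) j ≢ 0ℤ
  entry-row≢0 j = proj₁ (proj₂ (proj₂ (proj₂ mon) j))

  col-unique : ∀ i j → M i j ≢ 0ℤ → j ≡ col i
  col-unique i = proj₂ (proj₂ (proj₁ (proj₂ mon) i))

  row-unique : ∀ j i → M i j ≢ 0ℤ → i ≡ row j
  row-unique j = proj₂ (proj₂ (proj₂ (proj₂ mon) j))

  entry≡0-off-col : ∀ i j → j ≢ col i → M i j ≡ 0ℤ
  entry≡0-off-col i j j≢col = decidable-stable (M i j ≟ 0ℤ) (j≢col ∘ col-unique i j)

  entry≡0-off-row : ∀ j i → i ≢ row j → M i j ≡ 0ℤ
  entry≡0-off-row j i i≢row = decidable-stable (M i j ≟ 0ℤ) (i≢row ∘ row-unique j i)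

  ⊗-entry-col : ∀ (N : Mat n) i j → (M ⊗ N) i j ≡ M i (col i) * N (col i) j
  ⊗-entry-col N i j = ∑-single (col i) (λ l → M i l * N l j)
    (λ l l≢col → cong (_* N l j) (entry≡0-off-col i l l≢col))

  ⊗-entry-row : ∀ (N : Mat n) i j → (N ⊗ M) i j ≡ N i (row j) * M (row j) j
  ⊗-entry-row N i j = ∑-single (row j) (λ l → N i l * M l j)
    (λ l l≢row → trans (cong (N i l *_) (entry≡0-off-row j l l≢row)) (*-zeroʳ (N i l)))

IsMon-ᵀ : ∀ {n} {M : Mat n} → IsMon M → IsMon (M ᵀ)
IsMon-ᵀ (trits , rows , cols) = (λ i j → trits j i) , cols , rows

IsMon-⊗ : ∀ {n} {P Q : Mat n} → IsMon P → IsMon Q → IsMon (P ⊗ Q)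
IsMon-⊗ {n} {P} {Q} P-mon Q-mon = trits , rows , cols
  where
  module P = Monomial P-mon
  module Q = Monomial Q-mon

  *≢0 : ∀ {x y} → x ≢ 0ℤ → y ≢ 0ℤ → x * y ≢ 0ℤ
  *≢0 {x} x≢0 y≢0 xy≡0 = [ x≢0 , y≢0 ]′ (i*j≡0⇒i≡0∨j≡0 x xy≡0)

  trits : ∀ i j → Trit ((P ⊗ Q) i j)
  trits i j = subst Trit (sym (P.⊗-entry-col Q i j)) (Trit-* (proj₁ P-mon i (P.col i)) (proj₁ Q-mon (P.col i) j))

  rows : ∀ i → Σ (Fin n) λ j → ((P ⊗ Q) i j ≢ 0ℤ) × (∀ j' → (P ⊗ Q) i j' ≢ 0ℤ → j' ≡ j)
  rows i = Q.col (P.col i) , nonzero , unique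
    where
    nonzero : (P ⊗ Q) i (Q.col (P.col i)) ≢ 0ℤ
    nonzero rewrite P.⊗-entry-col Q i (Q.col (P.col i)) = *≢0 (P.entry-col≢0 i) (Q.entry-col≢0 (P.col i))
    unique : ∀ j → (P ⊗ Q) i j ≢ 0ℤ → j ≡ Q.col (P.col i)
    unique j entry≢0 = Q.col-unique (P.col i) j λ Q≡0 →
      entry≢0 (trans (P.⊗-entry-col Q i j) (trans (cong (P i (P.col i) *_) Q≡0) (*-zeroʳ (P i (P.col i)))))

  cols : ∀ j → Σ (Fin n) λ i → ((P ⊗ Q) i j ≢ 0ℤ) × (∀ i' → (P ⊗ Q) i' j ≢ 0ℤ → i' ≡ i)
  cols j = P.row (Q.row j) , nonzero , unique
    where
    nonzero : (P ⊗ Q) (P.row (Q.row j)) j ≢ 0ℤ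
    nonzero rewrite Q.⊗-entry-row P (P.row (Q.row j)) j = *≢0 (P.entry-row≢0 (Q.row j)) (Q.entry-row≢0 j)
    unique : ∀ i → (P ⊗ Q) i j ≢ 0ℤ → i ≡ P.row (Q.row j)
    unique i entry≢0 = P.row-unique (Q.row j) i λ P≡0 →
      entry≢0 (trans (Q.⊗-entry-row P i j) (cong (_* Q (Q.row j) j) P≡0))

M⊗Mᵀ≋I : ∀ {n} {M : Mat n} → IsMon M → M ⊗ M ᵀ ≋ I
M⊗Mᵀ≋I {M = M} mon i j with i ≟ᶠ j
... | yes refl = begin
  (M ⊗ M ᵀ) i i              ≡⟨ ⊗-entry-col (M ᵀ) i i ⟩
  M i (col i) * M i (col i)  ≡⟨ Trit∧≢0⇒x*x≡1 (proj₁ mon i (col i)) (entry-col≢0 i) ⟩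
  1ℤ                         ≡⟨ sym (δ-refl i) ⟩
  δ i i                      ∎
  where open Monomial mon
        open ≡-Reasoning
... | no i≢j = begin
  (M ⊗ M ᵀ) i j              ≡⟨ ⊗-entry-col (M ᵀ) i j ⟩
  M i (col i) * M j (col i)  ≡⟨ cong (M i (col i) *_) (entry≡0-off-row (col i) j j≢row) ⟩
  M i (col i) * 0ℤ           ≡⟨ *-zeroʳ (M i (col i)) ⟩
  0ℤ                         ≡⟨ sym (δ-≢ i≢j) ⟩
  δ i j                      ∎
  where open Monomial mon
        open ≡-Reasoning
        j≢row : j ≢ row (col i)
        j≢row j≡row = i≢j (trans (row-unique (col i) i (entry-col≢0 i)) (sym j≡row))

⊗-dagger : (n : ℕ) → Dagger (⊗-monoid n) 0ℓ
⊗-dagger n = record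
  { _†             = _ᵀ
  ; †-cong         = ᵀ-cong
  ; †-involutive   = ᵀ-involutive
  ; †-anti-homo-∙  = ᵀ-anti-homo-⊗
  ; Unitary        = IsMon
  ; Unitary-†      = IsMon-ᵀ
  ; Unitary-∙      = IsMon-⊗
  ; Unitary⇒x∙x†≃ε = M⊗Mᵀ≋I
  }

SHEquiv-resp : ∀ {n} {B B' C C' : Mat n} → B ≋ B' → C ≋ C' → SHEquiv B C → SHEquiv B' C'
SHEquiv-resp B≋B' C≋C' (M , M-mon , C≋MBMᵀ) =
  M , M-mon , ≋-trans (≋-sym C≋C') (≋-trans C≋MBMᵀ (⊗-cong (⊗-cong (≋-refl {x = M}) B≋B') ≋-refl))

σ-form : ∀ {n} (A : Mat n) (s : Bool → TElem n) {L R} → s true ≡ triple L R → σ A s ≋ L ᵀ ⊗ A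
σ-form A s s-true≡ rewrite s-true≡ = ≋-refl

module _ {n : ℕ} (A : Mat n) where

  open DaggerProperties (⊗-dagger n)

  record SectionForm (s₁ s₀ : TElem n) : Set where
    field
      L R L₀ R₀ : Mat n
      s₁≡       : s₁ ≡ triple L R
      s₀≡       : s₀ ≡ pair L₀ R₀
      L-mon     : IsMon L
      R≋Lᵀ      : R ≋ L ᵀ
      L₀≋I      : L₀ ≋ I
      R₀≋I      : R₀ ≋ I
      L-fixes   : L ⊗ A ᵀ ⊗ L ≋ A

  sectionForm : ∀ {s} → IsSection A s → SectionForm (s true) (s false)
  sectionForm (s∈TAut , s-hom , s-proj) =
    form (s-proj true) (s-proj false) (s∈TAut true) (s∈TAut false) (s-hom true true) (s-hom false false)
    where
    form : ∀ {s₁ s₀} → proj s₁ ≡ true → proj s₀ ≡ false → InTAut A s₁ → InTAut A s₀ →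
           s₀ ≈ s₁ · s₁ → s₀ ≈ s₀ · s₀ → SectionForm s₁ s₀
    form {triple L R} {pair L₀ R₀} refl refl (L-mon , _ , LAᵀRᵀ≋A) (L₀-mon , R₀-mon , _)
         (L₀≋LR , _) (L₀≋L₀L₀ , R₀≋R₀R₀) =
      record
        { s₁≡     = refl
        ; s₀≡     = refl
        ; L-mon   = L-mon
        ; R≋Lᵀ    = R≋Lᵀ
        ; L₀≋I    = x≃x∙x⇒x≃ε L₀-mon L₀≋L₀L₀
        ; R₀≋I    = x≃x∙x⇒x≃ε R₀-mon R₀≋R₀R₀
        ; L-fixes = ≋-trans (⊗-cong (≋-refl {x = L ⊗ A ᵀ}) (ᵀ-cong (≋-sym R≋Lᵀ))) LAᵀRᵀ≋A
        }
      where
      R≋Lᵀ : R ≋ L ᵀ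
      R≋Lᵀ = x∙y≃ε⇒y≃x† L-mon (≋-trans (≋-sym L₀≋LR) (x≃x∙x⇒x≃ε L₀-mon L₀≋L₀L₀))

  conjugate⇒SHEquiv : ∀ {g L R L' R'} → InTAut A g → IsMon L → L ⊗ A ᵀ ⊗ L ≋ A → R ≋ L ᵀ →
                      triple L' R' ≈ g · triple L R · inv g → SHEquiv (L ᵀ ⊗ A) (L' ᵀ ⊗ A)
  conjugate⇒SHEquiv {pair P Q} (P-mon , Q-mon , PAQᵀ≋A) _ _ _ (L'≋PLQᵀ , _) =
    Q , Q-mon , congruence-of-conjugate P-mon PAQᵀ≋A L'≋PLQᵀ
  conjugate⇒SHEquiv {triple P Q} {L} (P-mon , Q-mon , PAᵀQᵀ≋A) L-mon L-fixes R≋Lᵀ (L'≋PRQᵀ , _) =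
    Q ⊗ L , IsMon-⊗ Q-mon L-mon , congruence-of-twisted-conjugate P-mon L-mon L-fixes PAᵀQᵀ≋A R≋Lᵀ L'≋PRQᵀ

  EquivSections⇒SHEquiv : ∀ {s s'} (f : SectionForm (s true) (s false)) (f' : SectionForm (s' true) (s' false)) →
                          EquivSections A s s' → SHEquiv (SectionForm.L f ᵀ ⊗ A) (SectionForm.L f' ᵀ ⊗ A)
  EquivSections⇒SHEquiv f f' (g , g∈TAut , s'≈gsg⁻¹) =
    conjugate⇒SHEquiv g∈TAut L-mon L-fixes R≋Lᵀ
      (subst₂ (λ t' t → t' ≈ g · t · inv g) s₁≡' s₁≡ (s'≈gsg⁻¹ true))
    where
    open SectionForm f
    open SectionForm f' using () renaming (s₁≡ to s₁≡')

  SHEquiv⇒EquivSections : ∀ {s s'} (f : SectionForm (s true) (s false)) (f' : SectionForm (s' true) (s' false)) →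
                          SHEquiv (SectionForm.L f ᵀ ⊗ A) (SectionForm.L f' ᵀ ⊗ A) → EquivSections A s s'
  SHEquiv⇒EquivSections {s} {s'} f f' (M , M-mon , L'ᵀA≋M[LᵀA]Mᵀ) =
    pair P M , (P-mon , M-mon , congruence-fixes L'-mon L'ᵀA≋M[LᵀA]Mᵀ) , s'≈gsg⁻¹
    where
    open SectionForm f
    open SectionForm f' using () renaming (L to L'; s₁≡ to s₁≡'; s₀≡ to s₀≡'; L-mon to L'-mon;
                                           R≋Lᵀ to R'≋L'ᵀ; L₀≋I to L₀'≋I; R₀≋I to R₀'≋I)
    P : Mat n
    P = L' ⊗ M ⊗ L ᵀ
    P-mon : IsMon P
    P-mon = IsMon-⊗ (IsMon-⊗ L'-mon M-mon) (IsMon-ᵀ L-mon)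
    s'≈gsg⁻¹ : ∀ a → s' a ≈ pair P M · s a · inv (pair P M)
    s'≈gsg⁻¹ false rewrite s₀≡ | s₀≡' =
      x≃ε∧y≃ε⇒y≃z∙x∙z† P-mon L₀≋I L₀'≋I , x≃ε∧y≃ε⇒y≃z∙x∙z† M-mon R₀≋I R₀'≋I
    s'≈gsg⁻¹ true  rewrite s₁≡ | s₁≡' = congruence-conjugates L-mon M-mon R≋Lᵀ R'≋L'ᵀ

proposition5p5 : (n : ℕ) (A : Mat n) → IsWeighing A → SymmetricClass A →
    (s s' : Bool → TElem n) → IsSection A s → IsSection A s' →
    (EquivSections A s s' → SHEquiv (σ A s) (σ A s')) × (SHEquiv (σ A s) (σ A s') → EquivSections A s s')
proposition5p5 n A _ _ s s' s-section s'-section =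
    (λ s∼s' → SHEquiv-resp (≋-sym σs≋) (≋-sym σs'≋) (EquivSections⇒SHEquiv A f f' s∼s'))
  , (λ σs∼σs' → SHEquiv⇒EquivSections A f f' (SHEquiv-resp σs≋ σs'≋ σs∼σs'))
  where
  f : SectionForm A (s true) (s false)
  f = sectionForm A s-section
  f' : SectionForm A (s' true) (s' false)
  f' = sectionForm A s'-section
  σs≋ : σ A s ≋ SectionForm.L f ᵀ ⊗ A
  σs≋ = σ-form A s (SectionForm.s₁≡ f)
  σs'≋ : σ A s' ≋ SectionForm.L f' ᵀ ⊗ A
  σs'≋ = σ-form A s' (SectionForm.s₁≡ f')
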